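{- Let $D=(d_1,\ldots,d_n)$, with $d_1\ge d_2\ge\cdots\ge d_n$, be a forcibly unicyclic graphic sequence with $n\ge 6$. Then $d_6=1$.
   Context: All graphs are simple. A realization of a sequence $D=(d_1,\ldots,d_n)$ is a simple graph with vertices $v_1,\ldots,v_n$ with $\deg(v_i)=d_i$; $D$ is graphic if it has a realization. A graphic sequence is forcibly unicyclic if every realization of it is connected and has exactly $n$ edges. -}

module Defs where

open import Data.Nat using (ℕ; zero; suc; _+_; _≤_; _<_)
open import Data.Bool using (Bool; true; false)
open import Data.Fin using (Fin; toℕ)
open import Data.Product using (Σ; _×_; ∃)
open import Data.List using (List; length; filter; allFin; concatMap; map)
open import Data.Fin.Properties using (_<?_)
open import Relation.Binary.PropositionalEquality using (_≡_)
open import Relation.Binary.Construct.Closure.ReflexiveTransitive using (Star)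
open import Relation.Nullary using (¬_)
open import Relation.Nullary.Decidable using (Dec)
open import Data.Bool using (T)

-- A simple graph on vertex set Fin n (vertex i is v_{i+1}),
-- given by a symmetric, irreflexive Boolean adjacency relation.
record Graph (n : ℕ) : Set where
  field
    adj   : Fin n → Fin n → Bool
    sym   : ∀ i j → adj i j ≡ adj j i
    irrefl : ∀ i → adj i i ≡ false
open Graph public

Adj : ∀ {n} → Graph n → Fin n → Fin n → Set
Adj G i j = adj G i j ≡ true

degree : ∀ {n} → Graph n → Fin n → ℕ
degree {n} G i = length (filter (λ j → Data.Bool._≟_ (adj G i j) true) (allFin n))

pairs : (n : ℕ) → List (Fin n × Fin n)
pairs n = concatMap (λ i → filter (λ p → Data.Product.proj₁ p <? Data.Product.proj₂ p)
                                  (map (λ j → i Data.Product., j) (allFin n)))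
                    (allFin n)

edgeCount : ∀ {n} → Graph n → ℕ
edgeCount {n} G = length (filter (λ p → Data.Bool._≟_ (adj G (Data.Product.proj₁ p) (Data.Product.proj₂ p)) true) (pairs n))

Connected : ∀ {n} → Graph n → Set
Connected {n} G = ∀ (i j : Fin n) → Star (Adj G) i j

Realization : ∀ {n} → (Fin n → ℕ) → Graph n → Set
Realization {n} d G = ∀ (i : Fin n) → degree G i ≡ d i

Graphic : ∀ {n} → (Fin n → ℕ) → Set
Graphic {n} d = Σ (Graph n) (λ G → Realization d G)

ForciblyUnicyclic : ∀ {n} → (Fin n → ℕ) → Set
ForciblyUnicyclic {n} d =
  Graphic d × (∀ (G : Graph n) → Realization d G → Connected G × edgeCount G ≡ n)

NonIncreasing : ∀ {n} → (Fin n → ℕ) → Set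
NonIncreasing {n} d = ∀ (i j : Fin n) → toℕ i ≤ toℕ j → d j ≤ d i

module Submission where

-- Every realization of a forcibly unicyclic d is connected with n edges, so d sums to 2n and has
-- no zero entry. If d₆ ≥ 2 we build a disconnected realization. While the last entry is 1, the
-- degree sum forces some other entry to be at least 3: realize d with its last vertex removed and
-- that entry lowered by one, then attach the last vertex as a leaf there. Once no entry is 1 every
-- entry is 2, and a triangle beside a cycle on the other n - 3 ≥ 3 vertices realizes d.

open import Defs hiding (sym)
open import Data.Bool as Bool using (Bool; true; false; _∨_; _∧_)
open import Data.Bool.Properties using (∨-comm)
open import Data.Empty using (⊥-elim)
open import Data.Fin as Fin using (Fin; zero; suc; toℕ; fromℕ; fromℕ<; inject₁; punchIn; splitAt)
open import Data.Fin.Permutation using (Permutation′; permutation; _⟨$⟩ʳ_; _⟨$⟩ˡ_; inverseˡ; inverseʳ)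
open import Data.Fin.Properties as Finₚ using (_≟_; _<?_; <-cmp; punchInᵢ≢i; toℕ-inject₁; +↔⊎; splitAt-join)
open import Data.Fin.Relation.Unary.Top using (View; view; ‵fromℕ; ‵inj₁; view-fromℕ; view-inject₁)
open import Data.List using (List; []; _∷_; _++_; length; filter; tabulate; concatMap; allFin)
import Data.List as List
open import Data.List.Properties using (length-++; filter-++; map-tabulate)
open import Data.Nat as ℕ using (ℕ; zero; suc; _+_; _≤_; _<_; z≤n; s≤s; pred; _≤?_; >-nonZero)
open import Data.Nat.Properties
  using ( +-0-commutativeMonoid; +-comm; +-assoc; +-suc; +-identityʳ; +-mono-≤; +-monoʳ-≤; +-cancelʳ-≤
        ; ≤-trans; ≤-reflexive; ≤-antisym; ≤-pred; m≤m+n; 1+n≰n; ≰⇒>; ≮⇒≥; ≤∧≢⇒<; m≢1+n+m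
        ; suc-injective; suc-pred; pred-mono-≤; m≤n⇒∃[o]m+o≡n; module ≤-Reasoning)
open import Data.Product using (Σ; _×_; _,_; proj₁; proj₂)
open import Data.Sum using (inj₁; inj₂; [_,_]; map)
open import Data.Sum.Properties using (inj₁-injective; inj₂-injective)
open import Data.Sum.Function.Propositional using (_⊎-↔_)
open import Data.Vec.Functional using (removeAt; updateAt)
open import Data.Vec.Functional.Properties using (updateAt-updates; updateAt-minimal)
open import Function using (_∘_; id; const)
open import Function.Construct.Composition using (_↔-∘_)
open import Function.Construct.Symmetry using (↔-sym)
open import Relation.Binary using (tri<; tri≈; tri>)
open import Relation.Binary.Construct.Closure.ReflexiveTransitive using (Star; ε; _◅_; fold)
open import Relation.Binary.PropositionalEquality
  using (_≡_; _≢_; refl; sym; trans; cong; cong₂; subst; subst₂; module ≡-Reasoning)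
open import Relation.Nullary using (¬_; Dec; yes; no; does)
open import Relation.Nullary.Decidable using (dec-true; dec-false)
open import Relation.Unary using (Pred; Decidable)
open import Relation.Unary.Properties using (_∩?_)
open import Algebra.Properties.CommutativeMonoid.Sum +-0-commutativeMonoid
  using (sum; sum-syntax; sum-cong-≗; sum-remove; sum-replicate-zero; sum-init-last; ∑-distrib-+; ∑-comm)

𝟙 : Bool → ℕ
𝟙 true = 1
𝟙 false = 0

∑-𝟙-≟ : ∀ {n} (a : Fin n) → ∑[ j < n ] 𝟙 (does (j ≟ a)) ≡ 1
∑-𝟙-≟ {suc n} zero = cong suc (sum-replicate-zero n)
∑-𝟙-≟ {suc n} (suc a) = ∑-𝟙-≟ a

∑-mono-≤ : ∀ {n} {f g : Fin n → ℕ} → (∀ i → f i ≤ g i) → ∑[ i < n ] f i ≤ ∑[ i < n ] g i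
∑-mono-≤ {zero} _ = z≤n
∑-mono-≤ {suc n} f≤g = +-mono-≤ (f≤g zero) (∑-mono-≤ (f≤g ∘ suc))

∑-2≡n+n : ∀ n → ∑[ i < n ] 2 ≡ n + n
∑-2≡n+n zero = refl
∑-2≡n+n (suc n) = trans (cong (2 +_) (∑-2≡n+n n)) (cong suc (sym (+-suc n n)))

entry≤∑ : ∀ {n} (f : Fin (suc n) → ℕ) k → f k ≤ ∑[ i < suc n ] f i
entry≤∑ f k = ≤-trans (m≤m+n (f k) _) (≤-reflexive (sym (sum-remove f)))

entries≡2 : ∀ {n} (f : Fin n → ℕ) → (∀ i → 2 ≤ f i) → ∑[ i < n ] f i ≡ n + n → ∀ i → f i ≡ 2
entries≡2 {suc n} f 2≤f ∑f≡ k = ≤-antisym (+-cancelʳ-≤ (n + n) (f k) 2 (begin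
  f k + (n + n)              ≤⟨ +-monoʳ-≤ (f k) (≤-trans (≤-reflexive (sym (∑-2≡n+n n))) (∑-mono-≤ (2≤f ∘ punchIn k))) ⟩
  f k + sum (removeAt f k)   ≡⟨ sym (sum-remove f) ⟩
  sum f                      ≡⟨ ∑f≡ ⟩
  suc n + suc n              ≡⟨ cong suc (+-suc n n) ⟩
  2 + (n + n)                ∎)) (2≤f k)
  where open ≤-Reasoning

module _ {a p} {A : Set a} {P : Pred A p} (P? : Decidable P) where

  length-filter-tabulate : ∀ {n} (f : Fin n → A) →
    length (filter P? (tabulate f)) ≡ ∑[ i < n ] 𝟙 (does (P? (f i)))
  length-filter-tabulate {zero} f = refl
  length-filter-tabulate {suc n} f with does (P? (f zero))
  ... | true = cong suc (length-filter-tabulate (f ∘ suc))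
  ... | false = length-filter-tabulate (f ∘ suc)

  filter-filter : ∀ {q} {Q : Pred A q} (Q? : Decidable Q) (xs : List A) →
    filter P? (filter Q? xs) ≡ filter (Q? ∩? P?) xs
  filter-filter Q? [] = refl
  filter-filter Q? (x ∷ xs) with does (Q? x)
  ... | false = filter-filter Q? xs
  ... | true with does (P? x)
  ...   | true = cong (x ∷_) (filter-filter Q? xs)
  ...   | false = filter-filter Q? xs

  length-filter-concatMap-tabulate : ∀ {b} {B : Set b} {n} (g : B → List A) (f : Fin n → B) →
    length (filter P? (concatMap g (tabulate f))) ≡ ∑[ i < n ] length (filter P? (g (f i)))
  length-filter-concatMap-tabulate {n = zero} g f = refl
  length-filter-concatMap-tabulate {n = suc n} g f = begin
    length (filter P? (g (f zero) ++ concatMap g (tabulate (f ∘ suc))))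
      ≡⟨ cong length (filter-++ P? (g (f zero)) _) ⟩
    length (filter P? (g (f zero)) ++ filter P? (concatMap g (tabulate (f ∘ suc))))
      ≡⟨ length-++ (filter P? (g (f zero))) ⟩
    length (filter P? (g (f zero))) + length (filter P? (concatMap g (tabulate (f ∘ suc))))
      ≡⟨ cong (length (filter P? (g (f zero))) +_) (length-filter-concatMap-tabulate g (f ∘ suc)) ⟩
    ∑[ i < suc n ] length (filter P? (g (f i))) ∎
    where open ≡-Reasoning

deg : ∀ {n} → Graph n → Fin n → ℕ
deg {n} G i = ∑[ j < n ] 𝟙 (adj G i j)

𝟙-≟-true : ∀ b → 𝟙 (does (b Bool.≟ true)) ≡ 𝟙 b
𝟙-≟-true true = refl
𝟙-≟-true false = refl

degree≡deg : ∀ {n} (G : Graph n) i → degree G i ≡ deg G i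
degree≡deg {n} G i = trans (length-filter-tabulate (λ j → adj G i j Bool.≟ true) id)
  (sum-cong-≗ (λ j → 𝟙-≟-true (adj G i j)))

module _ {n} (G : Graph n) where

  upper : Fin n → Fin n → ℕ
  upper i j = 𝟙 (does (i <? j) ∧ does (adj G i j Bool.≟ true))

  edgeCount≡∑upper : edgeCount G ≡ ∑[ i < n ] ∑[ j < n ] upper i j
  edgeCount≡∑upper = begin
    edgeCount G
      ≡⟨ length-filter-concatMap-tabulate Adj? row id ⟩
    ∑[ i < n ] length (filter Adj? (row i))
      ≡⟨ sum-cong-≗ (λ i → cong (length ∘ filter Adj? ∘ filter Lt?) (map-tabulate id (i ,_))) ⟩
    ∑[ i < n ] length (filter Adj? (filter Lt? (tabulate (i ,_))))
      ≡⟨ sum-cong-≗ (λ i → trans (cong length (filter-filter Adj? Lt? (tabulate (i ,_))))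
                                 (length-filter-tabulate (Lt? ∩? Adj?) (i ,_))) ⟩
    ∑[ i < n ] ∑[ j < n ] upper i j ∎
    where
    open ≡-Reasoning
    Adj? : (p : Fin n × Fin n) → Dec (adj G (proj₁ p) (proj₂ p) ≡ true)
    Adj? (i , j) = adj G i j Bool.≟ true
    Lt? : (p : Fin n × Fin n) → Dec (proj₁ p Fin.< proj₂ p)
    Lt? (i , j) = i <? j
    row : Fin n → List (Fin n × Fin n)
    row i = filter Lt? (List.map (i ,_) (allFin n))

  𝟙-adj≡upper+upper : ∀ i j → 𝟙 (adj G i j) ≡ upper i j + upper j i
  𝟙-adj≡upper+upper i j with <-cmp i j
  ... | tri< i<j _ j≮i rewrite dec-true (i <? j) i<j | dec-false (j <? i) j≮i =
    trans (sym (𝟙-≟-true (adj G i j))) (sym (+-identityʳ _))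
  ... | tri> i≮j _ j<i rewrite dec-false (i <? j) i≮j | dec-true (j <? i) j<i =
    trans (cong 𝟙 (Graph.sym G i j)) (sym (𝟙-≟-true (adj G j i)))
  ... | tri≈ i≮i refl _ rewrite dec-false (i <? i) i≮i | Graph.irrefl G i = refl

  handshake : ∑[ i < n ] deg G i ≡ edgeCount G + edgeCount G
  handshake = begin
    ∑[ i < n ] ∑[ j < n ] 𝟙 (adj G i j)
      ≡⟨ sum-cong-≗ (λ i → trans (sum-cong-≗ (𝟙-adj≡upper+upper i)) (∑-distrib-+ (upper i) (λ j → upper j i))) ⟩
    ∑[ i < n ] (∑[ j < n ] upper i j + ∑[ j < n ] upper j i)
      ≡⟨ ∑-distrib-+ (λ i → ∑[ j < n ] upper i j) (λ i → ∑[ j < n ] upper j i) ⟩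
    ∑[ i < n ] ∑[ j < n ] upper i j + ∑[ i < n ] ∑[ j < n ] upper j i
      ≡⟨ cong (∑[ i < n ] ∑[ j < n ] upper i j +_) (∑-comm (λ i j → upper j i)) ⟩
    ∑[ i < n ] ∑[ j < n ] upper i j + ∑[ j < n ] ∑[ i < n ] upper j i
      ≡⟨ sym (cong₂ _+_ edgeCount≡∑upper edgeCount≡∑upper) ⟩
    edgeCount G + edgeCount G ∎
    where open ≡-Reasoning

record Disconnection {n} (G : Graph n) : Set where
  field
    side : Fin n → Bool
    side-adj : ∀ {i j} → Adj G i j → side i ≡ side j
    u v : Fin n
    side-u≢side-v : side u ≢ side v

disconnection⇒¬connected : ∀ {n} {G : Graph n} → Disconnection G → ¬ Connected G
disconnection⇒¬connected D connected =
  side-u≢side-v (fold (λ i j → side i ≡ side j) (λ e → trans (side-adj e)) refl (connected u v))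
  where open Disconnection D

adj⇒1≤deg : ∀ {n} (G : Graph (suc n)) {i j} → Adj G i j → 1 ≤ deg G i
adj⇒1≤deg G {i} {j} i~j = ≤-trans (≤-reflexive (cong 𝟙 (sym i~j))) (entry≤∑ (𝟙 ∘ adj G i) j)

walk⇒neighbour : ∀ {n} {G : Graph n} {i j} → Star (Adj G) i j → i ≢ j → Σ (Fin n) (Adj G i)
walk⇒neighbour ε i≢i = ⊥-elim (i≢i refl)
walk⇒neighbour (i~k ◅ _) _ = _ , i~k

connected⇒1≤deg : ∀ {n} (G : Graph (suc (suc n))) → Connected G → ∀ i → 1 ≤ deg G i
connected⇒1≤deg G connected i =
  adj⇒1≤deg G (proj₂ (walk⇒neighbour {G = G} (connected i (punchIn i zero)) (punchInᵢ≢i i zero ∘ sym)))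

record DisconnectedRealization {n} (d : Fin n → ℕ) : Set where
  field
    graph : Graph n
    deg≡ : ∀ i → deg graph i ≡ d i
    disconnection : Disconnection graph

-- π² has no fixed point: every cycle of π has length at least 3
NoShortCycles : ∀ {n} → Permutation′ n → Set
NoShortCycles π = ∀ x → π ⟨$⟩ʳ x ≢ π ⟨$⟩ˡ x

module PermutationGraph {n} (π : Permutation′ n) (π≢π⁻¹ : NoShortCycles π) where

  π-fixes-none : ∀ x → π ⟨$⟩ʳ x ≢ x
  π-fixes-none x πx≡x = π≢π⁻¹ x (trans πx≡x (sym (trans (cong (π ⟨$⟩ˡ_) (sym πx≡x)) (inverseˡ π))))

  does-≟-π≡does-≟-π⁻¹ : ∀ x y → does (x ≟ π ⟨$⟩ʳ y) ≡ does (y ≟ π ⟨$⟩ˡ x)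
  does-≟-π≡does-≟-π⁻¹ x y with x ≟ π ⟨$⟩ʳ y | y ≟ π ⟨$⟩ˡ x
  ... | yes _ | yes _ = refl
  ... | no _ | no _ = refl
  ... | yes x≡πy | no y≢π⁻¹x = ⊥-elim (y≢π⁻¹x (sym (trans (cong (π ⟨$⟩ˡ_) x≡πy) (inverseˡ π))))
  ... | no x≢πy | yes y≡π⁻¹x = ⊥-elim (x≢πy (sym (trans (cong (π ⟨$⟩ʳ_) y≡π⁻¹x) (inverseʳ π))))

  graph : Graph n
  graph = record
    { adj = λ x y → does (y ≟ π ⟨$⟩ʳ x) ∨ does (x ≟ π ⟨$⟩ʳ y)
    ; sym = λ x y → ∨-comm (does (y ≟ π ⟨$⟩ʳ x)) (does (x ≟ π ⟨$⟩ʳ y))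
    ; irrefl = λ x → cong (λ b → b ∨ b) (dec-false (x ≟ π ⟨$⟩ʳ x) (π-fixes-none x ∘ sym))
    }

  𝟙-adj : ∀ x y → 𝟙 (adj graph x y) ≡ 𝟙 (does (y ≟ π ⟨$⟩ʳ x)) + 𝟙 (does (y ≟ π ⟨$⟩ˡ x))
  𝟙-adj x y rewrite does-≟-π≡does-≟-π⁻¹ x y with y ≟ π ⟨$⟩ʳ x | y ≟ π ⟨$⟩ˡ x
  ... | yes y≡πx | yes y≡π⁻¹x = ⊥-elim (π≢π⁻¹ x (trans (sym y≡πx) y≡π⁻¹x))
  ... | yes _ | no _ = refl
  ... | no _ | _ = refl

  deg≡2 : ∀ x → deg graph x ≡ 2
  deg≡2 x = begin
    ∑[ y < n ] 𝟙 (adj graph x y)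
      ≡⟨ sum-cong-≗ (𝟙-adj x) ⟩
    ∑[ y < n ] (𝟙 (does (y ≟ π ⟨$⟩ʳ x)) + 𝟙 (does (y ≟ π ⟨$⟩ˡ x)))
      ≡⟨ ∑-distrib-+ (λ y → 𝟙 (does (y ≟ π ⟨$⟩ʳ x))) (λ y → 𝟙 (does (y ≟ π ⟨$⟩ˡ x))) ⟩
    ∑[ y < n ] 𝟙 (does (y ≟ π ⟨$⟩ʳ x)) + ∑[ y < n ] 𝟙 (does (y ≟ π ⟨$⟩ˡ x))
      ≡⟨ cong₂ _+_ (∑-𝟙-≟ (π ⟨$⟩ʳ x)) (∑-𝟙-≟ (π ⟨$⟩ˡ x)) ⟩
    2 ∎
    where open ≡-Reasoning

  invariant-adj : (S : Fin n → Bool) → (∀ x → S (π ⟨$⟩ʳ x) ≡ S x) →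
    ∀ {x y} → Adj graph x y → S x ≡ S y
  invariant-adj S S-inv {x} {y} x~y with y ≟ π ⟨$⟩ʳ x | x ≟ π ⟨$⟩ʳ y
  ... | yes refl | _ = sym (S-inv x)
  ... | no _ | yes refl = S-inv y

module _ {m : ℕ} where

  rotate : Fin (suc m) → Fin (suc m)
  rotate i with view i
  ... | ‵fromℕ = zero
  ... | ‵inj₁ {i = j} _ = suc j

  rotate⁻¹ : Fin (suc m) → Fin (suc m)
  rotate⁻¹ zero = fromℕ m
  rotate⁻¹ (suc j) = inject₁ j

  rotate-fromℕ : rotate (fromℕ m) ≡ zero
  rotate-fromℕ rewrite view-fromℕ m = refl

  rotate-inject₁ : ∀ j → rotate (inject₁ j) ≡ suc j
  rotate-inject₁ j rewrite view-inject₁ j = refl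

  rotation : Permutation′ (suc m)
  rotation = permutation rotate rotate⁻¹ rotate-rotate⁻¹ rotate⁻¹-rotate
    where
    rotate-rotate⁻¹ : ∀ i → rotate (rotate⁻¹ i) ≡ i
    rotate-rotate⁻¹ zero = rotate-fromℕ
    rotate-rotate⁻¹ (suc j) = rotate-inject₁ j
    rotate⁻¹-rotate : ∀ i → rotate⁻¹ (rotate i) ≡ i
    rotate⁻¹-rotate i with view i
    ... | ‵fromℕ = refl
    ... | ‵inj₁ _ = refl

rotation-noShortCycles : ∀ k → NoShortCycles (rotation {2 + k})
-- matching on view i also evaluates rotate i on the left of eq
rotation-noShortCycles k i eq with view i
... | ‵fromℕ = Finₚ.0≢1+n eq
... | ‵inj₁ {i = zero} _ = Finₚ.0≢1+n (Finₚ.suc-injective eq)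
... | ‵inj₁ {i = suc j} _ = m≢1+n+m (toℕ j) (sym (begin
  suc (suc (toℕ j))               ≡⟨ cong toℕ eq ⟩
  toℕ (inject₁ (inject₁ j))       ≡⟨ toℕ-inject₁ (inject₁ j) ⟩
  toℕ (inject₁ j)                 ≡⟨ toℕ-inject₁ j ⟩
  toℕ j                           ∎))
  where open ≡-Reasoning

isLeft : ∀ m {n} → Fin (m + n) → Bool
isLeft m x = [ const true , const false ] (splitAt m x)

_⊎ₚ_ : ∀ {m n} → Permutation′ m → Permutation′ n → Permutation′ (m + n)
ρ ⊎ₚ τ = ↔-sym +↔⊎ ↔-∘ ((ρ ⊎-↔ τ) ↔-∘ +↔⊎)

module _ {m n} (ρ : Permutation′ m) (τ : Permutation′ n) where

  ⊎ₚ-noShortCycles : NoShortCycles ρ → NoShortCycles τ → NoShortCycles (ρ ⊎ₚ τ)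
  ⊎ₚ-noShortCycles ρ-ok τ-ok x eq = on-halves (splitAt m x)
    (trans (sym (splitAt-join m n (map (ρ ⟨$⟩ʳ_) (τ ⟨$⟩ʳ_) (splitAt m x))))
      (trans (cong (splitAt m) eq) (splitAt-join m n (map (ρ ⟨$⟩ˡ_) (τ ⟨$⟩ˡ_) (splitAt m x)))))
    where
    on-halves : ∀ s → map (ρ ⟨$⟩ʳ_) (τ ⟨$⟩ʳ_) s ≢ map (ρ ⟨$⟩ˡ_) (τ ⟨$⟩ˡ_) s
    on-halves (inj₁ a) = ρ-ok a ∘ inj₁-injective
    on-halves (inj₂ b) = τ-ok b ∘ inj₂-injective

  isLeft-⊎ₚ : ∀ x → isLeft m ((ρ ⊎ₚ τ) ⟨$⟩ʳ x) ≡ isLeft m x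
  isLeft-⊎ₚ x = trans (cong [ const true , const false ] (splitAt-join m n (map (ρ ⟨$⟩ʳ_) (τ ⟨$⟩ʳ_) (splitAt m x))))
    (on-halves (splitAt m x))
    where
    on-halves : ∀ s → [ const true , const false ] (map (ρ ⟨$⟩ʳ_) (τ ⟨$⟩ʳ_) s) ≡ [ const true , const false ] s
    on-halves (inj₁ _) = refl
    on-halves (inj₂ _) = refl

triangle⊎cycle : ∀ k → DisconnectedRealization {3 + (3 + k)} (const 2)
triangle⊎cycle k = record
  { graph = graph
  ; deg≡ = deg≡2
  ; disconnection = record
    { side = isLeft 3
    ; side-adj = λ {i} {j} → invariant-adj (isLeft 3) (isLeft-⊎ₚ ρ τ) {i} {j}
    ; u = zero
    ; v = suc (suc (suc zero))
    ; side-u≢side-v = λ ()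
    }
  }
  where
  ρ : Permutation′ 3
  ρ = rotation
  τ : Permutation′ (3 + k)
  τ = rotation
  open PermutationGraph (ρ ⊎ₚ τ) (⊎ₚ-noShortCycles ρ τ (rotation-noShortCycles 0) (rotation-noShortCycles k))

disconnected-2-regular : ∀ {n} → 6 ≤ n → DisconnectedRealization {n} (const 2)
disconnected-2-regular 6≤n with m≤n⇒∃[o]m+o≡n 6≤n
... | k , refl = triangle⊎cycle k

-- the new leaf is the last vertex, fromℕ m
module AttachLeaf {m} (H : Graph m) (p : Fin m) where

  adjView : ∀ {x y : Fin (suc m)} → View x → View y → Bool
  adjView ‵fromℕ ‵fromℕ = false
  adjView ‵fromℕ (‵inj₁ {i = b} _) = does (b ≟ p)
  adjView (‵inj₁ {i = a} _) ‵fromℕ = does (a ≟ p)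
  adjView (‵inj₁ {i = a} _) (‵inj₁ {i = b} _) = adj H a b

  adjView-sym : ∀ {x y} (vx : View x) (vy : View y) → adjView vx vy ≡ adjView vy vx
  adjView-sym ‵fromℕ ‵fromℕ = refl
  adjView-sym ‵fromℕ (‵inj₁ _) = refl
  adjView-sym (‵inj₁ _) ‵fromℕ = refl
  adjView-sym (‵inj₁ {i = a} _) (‵inj₁ {i = b} _) = Graph.sym H a b

  adjView-irrefl : ∀ {x} (vx : View x) → adjView vx vx ≡ false
  adjView-irrefl ‵fromℕ = refl
  adjView-irrefl (‵inj₁ {i = a} _) = Graph.irrefl H a

  graph : Graph (suc m)
  graph = record
    { adj = λ x y → adjView (view x) (view y)
    ; sym = λ x y → adjView-sym (view x) (view y)
    ; irrefl = λ x → adjView-irrefl (view x)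
    }

  adj-inject₁-inject₁ : ∀ a b → adj graph (inject₁ a) (inject₁ b) ≡ adj H a b
  adj-inject₁-inject₁ a b rewrite view-inject₁ a | view-inject₁ b = refl

  adj-inject₁-fromℕ : ∀ a → adj graph (inject₁ a) (fromℕ m) ≡ does (a ≟ p)
  adj-inject₁-fromℕ a rewrite view-inject₁ a | view-fromℕ m = refl

  adj-fromℕ-inject₁ : ∀ b → adj graph (fromℕ m) (inject₁ b) ≡ does (b ≟ p)
  adj-fromℕ-inject₁ b rewrite view-fromℕ m | view-inject₁ b = refl

  deg-inject₁ : ∀ a → deg graph (inject₁ a) ≡ deg H a + 𝟙 (does (a ≟ p))
  deg-inject₁ a = trans (sum-init-last (𝟙 ∘ adj graph (inject₁ a)))
    (cong₂ _+_ (sum-cong-≗ (cong 𝟙 ∘ adj-inject₁-inject₁ a)) (cong 𝟙 (adj-inject₁-fromℕ a)))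

  deg-fromℕ : deg graph (fromℕ m) ≡ 1
  deg-fromℕ = begin
    deg graph (fromℕ m)
      ≡⟨ sum-init-last (𝟙 ∘ adj graph (fromℕ m)) ⟩
    ∑[ b < m ] 𝟙 (adj graph (fromℕ m) (inject₁ b)) + 𝟙 (adj graph (fromℕ m) (fromℕ m))
      ≡⟨ cong₂ _+_ (sum-cong-≗ (cong 𝟙 ∘ adj-fromℕ-inject₁)) (cong 𝟙 (Graph.irrefl graph (fromℕ m))) ⟩
    ∑[ b < m ] 𝟙 (does (b ≟ p)) + 0
      ≡⟨ cong (_+ 0) (∑-𝟙-≟ p) ⟩
    1 ∎
    where open ≡-Reasoning

  disconnection : Disconnection H → Disconnection graph
  disconnection D = record
    { side = sideView ∘ view
    ; side-adj = λ {i} {j} → side-adjView (view i) (view j)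
    ; u = inject₁ u
    ; v = inject₁ v
    ; side-u≢side-v = λ eq → side-u≢side-v (trans (sym (side-inject₁ u)) (trans eq (side-inject₁ v)))
    }
    where
    open Disconnection D

    sideView : ∀ {x : Fin (suc m)} → View x → Bool
    sideView ‵fromℕ = side p
    sideView (‵inj₁ {i = a} _) = side a

    side-inject₁ : ∀ a → sideView (view (inject₁ a)) ≡ side a
    side-inject₁ a rewrite view-inject₁ a = refl

    side-adjView : ∀ {x y} (vx : View x) (vy : View y) → adjView vx vy ≡ true → sideView vx ≡ sideView vy
    side-adjView ‵fromℕ ‵fromℕ ()
    side-adjView ‵fromℕ (‵inj₁ {i = b} _) b~p with b ≟ p
    ... | yes refl = refl
    side-adjView (‵inj₁ {i = a} _) ‵fromℕ a~p with a ≟ p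
    ... | yes refl = refl
    side-adjView (‵inj₁ _) (‵inj₁ _) a~b = side-adj a~b

∃-entry≥3 : ∀ {m} (d : Fin (suc m) → ℕ) → ∑[ i < suc m ] d i ≡ suc m + suc m → d (fromℕ m) ≡ 1 →
  Σ (Fin m) λ p → 3 ≤ d (inject₁ p)
∃-entry≥3 {m} d ∑d≡ last≡1 with Finₚ.all? (λ i → d i ≤? 2)
... | yes d≤2 = ⊥-elim (1+n≰n (begin
  suc (m + m + 1)                              ≡⟨ cong suc (trans (+-assoc m m 1) (cong (m +_) (+-comm m 1))) ⟩
  suc m + suc m                                ≡⟨ sym ∑d≡ ⟩
  ∑[ i < suc m ] d i                           ≡⟨ sum-init-last d ⟩
  ∑[ b < m ] d (inject₁ b) + d (fromℕ m)       ≤⟨ +-mono-≤ (≤-trans (∑-mono-≤ (d≤2 ∘ inject₁)) (≤-reflexive (∑-2≡n+n m)))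
                                                          (≤-reflexive last≡1) ⟩
  m + m + 1                                    ∎))
  where open ≤-Reasoning
... | no ¬d≤2 with Finₚ.¬∀⟶∃¬ _ _ (λ i → d i ≤? 2) ¬d≤2
...   | p , dp≰2 with view p
...     | ‵fromℕ = ⊥-elim (dp≰2 (≤-trans (≤-reflexive last≡1) (s≤s z≤n)))
...     | ‵inj₁ {i = p′} _ = p′ , ≰⇒> dp≰2

-- The invariant of the leaf-removal induction; ones-suffix stands in for monotonicity,
-- which lowering an entry can break.
record Admissible {n} (d : Fin n → ℕ) : Set where
  field
    ∑≡n+n : ∑[ i < n ] d i ≡ n + n
    positive : ∀ i → 1 ≤ d i
    first-six≥2 : ∀ i → toℕ i < 6 → 2 ≤ d i
    ones-suffix : ∀ {i j} → toℕ i ≤ toℕ j → d i ≡ 1 → d j ≡ 1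

module RemoveLeaf {m} (d : Fin (suc m) → ℕ) (A : Admissible d) (last≡1 : d (fromℕ m) ≡ 1)
                  (p : Fin m) (3≤dp : 3 ≤ d (inject₁ p)) where
  open Admissible A

  reduced : Fin m → ℕ
  reduced = updateAt (d ∘ inject₁) p pred

  2≤reduced-p : 2 ≤ reduced p
  2≤reduced-p = subst (2 ≤_) (sym (updateAt-updates p (d ∘ inject₁))) (pred-mono-≤ 3≤dp)

  reduced≡d : ∀ {b} → b ≢ p → reduced b ≡ d (inject₁ b)
  reduced≡d b≢p = updateAt-minimal _ p (d ∘ inject₁) b≢p

  reduced+𝟙≡d : ∀ b → reduced b + 𝟙 (does (b ≟ p)) ≡ d (inject₁ b)
  reduced+𝟙≡d b with b ≟ p
  ... | yes refl = trans (cong (_+ 1) (updateAt-updates p (d ∘ inject₁)))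
    (trans (+-comm _ 1) (suc-pred _ {{>-nonZero (≤-trans (s≤s z≤n) 3≤dp)}}))
  ... | no b≢p = trans (+-identityʳ _) (reduced≡d b≢p)

  6≤m : 6 ≤ m
  6≤m = ≮⇒≥ λ m<6 → 1+n≰n (≤-trans (first-six≥2 (fromℕ m) (subst (_< 6) (sym (Finₚ.toℕ-fromℕ m)) m<6))
                                     (≤-reflexive last≡1))

  ∑reduced : ∑[ b < m ] reduced b ≡ m + m
  ∑reduced = suc-injective (suc-injective (begin
    2 + ∑[ b < m ] reduced b                                   ≡⟨ +-comm 2 _ ⟩
    ∑[ b < m ] reduced b + 2                                   ≡⟨ sym (+-assoc _ 1 1) ⟩
    ∑[ b < m ] reduced b + 1 + 1                               ≡⟨ cong (λ x → ∑[ b < m ] reduced b + x + 1) (sym (∑-𝟙-≟ p)) ⟩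
    ∑[ b < m ] reduced b + ∑[ b < m ] 𝟙 (does (b ≟ p)) + 1     ≡⟨ cong (_+ 1) (sym (∑-distrib-+ reduced _)) ⟩
    ∑[ b < m ] (reduced b + 𝟙 (does (b ≟ p))) + 1              ≡⟨ cong₂ _+_ (sum-cong-≗ reduced+𝟙≡d) (sym last≡1) ⟩
    ∑[ b < m ] d (inject₁ b) + d (fromℕ m)                     ≡⟨ sym (sum-init-last d) ⟩
    ∑[ i < suc m ] d i                                         ≡⟨ ∑≡n+n ⟩
    suc m + suc m                                              ≡⟨ cong suc (+-suc m m) ⟩
    2 + (m + m)                                                ∎))
    where open ≡-Reasoning

  admissible : Admissible reduced
  admissible = record
    { ∑≡n+n = ∑reduced
    ; positive = positive′
    ; first-six≥2 = first-six≥2′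
    ; ones-suffix = ones-suffix′
    }
    where
    positive′ : ∀ b → 1 ≤ reduced b
    positive′ b with b ≟ p
    ... | yes refl = ≤-trans (s≤s z≤n) 2≤reduced-p
    ... | no b≢p = subst (1 ≤_) (sym (reduced≡d b≢p)) (positive (inject₁ b))

    first-six≥2′ : ∀ b → toℕ b < 6 → 2 ≤ reduced b
    first-six≥2′ b b<6 with b ≟ p
    ... | yes refl = 2≤reduced-p
    ... | no b≢p = subst (2 ≤_) (sym (reduced≡d b≢p))
                     (first-six≥2 (inject₁ b) (subst (_< 6) (sym (toℕ-inject₁ b)) b<6))

    ones-suffix′ : ∀ {i j} → toℕ i ≤ toℕ j → reduced i ≡ 1 → reduced j ≡ 1
    ones-suffix′ {i} {j} i≤j ri≡1 = trans (reduced≡d j≢p) dj≡1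
      where
      i≢p : i ≢ p
      i≢p refl = 1+n≰n (≤-trans 2≤reduced-p (≤-reflexive ri≡1))
      dj≡1 : d (inject₁ j) ≡ 1
      dj≡1 = ones-suffix (subst₂ _≤_ (sym (toℕ-inject₁ i)) (sym (toℕ-inject₁ j)) i≤j)
                         (trans (sym (reduced≡d i≢p)) ri≡1)
      j≢p : j ≢ p
      j≢p refl = 1+n≰n (≤-trans (≤-trans (s≤s (s≤s z≤n)) 3≤dp) (≤-reflexive dj≡1))

  attach : DisconnectedRealization reduced → DisconnectedRealization d
  attach R = record
    { graph = AttachLeaf.graph graph p
    ; deg≡ = deg≡′ ∘ view
    ; disconnection = AttachLeaf.disconnection graph p disconnection
    }
    where
    open DisconnectedRealization R
    deg≡′ : ∀ {x} → View x → deg (AttachLeaf.graph graph p) x ≡ d x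
    deg≡′ ‵fromℕ = trans (AttachLeaf.deg-fromℕ graph p) (sym last≡1)
    deg≡′ (‵inj₁ {i = b} _) = begin
      deg (AttachLeaf.graph graph p) (inject₁ b)  ≡⟨ AttachLeaf.deg-inject₁ graph p b ⟩
      deg graph b + 𝟙 (does (b ≟ p))              ≡⟨ cong (_+ 𝟙 (does (b ≟ p))) (deg≡ b) ⟩
      reduced b + 𝟙 (does (b ≟ p))                ≡⟨ reduced+𝟙≡d b ⟩
      d (inject₁ b)                               ∎
      where open ≡-Reasoning

no-leaf⇒entries≡2 : ∀ {m} {d : Fin (suc m) → ℕ} → Admissible d → d (fromℕ m) ≢ 1 → ∀ i → d i ≡ 2
no-leaf⇒entries≡2 {m} {d} A last≢1 = entries≡2 d 2≤d ∑≡n+n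
  where
  open Admissible A
  2≤d : ∀ i → 2 ≤ d i
  2≤d i = ≤∧≢⇒< (positive i) (λ 1≡di → last≢1 (ones-suffix (Finₚ.≤fromℕ i) (sym 1≡di)))

disconnected-realization : ∀ {n} (d : Fin n → ℕ) → 6 ≤ n → Admissible d → DisconnectedRealization d
disconnected-realization {suc m} d 6≤n A with d (fromℕ m) ℕ.≟ 1
... | no last≢1 = record { graph = graph ; deg≡ = λ i → trans (deg≡ i) (sym (no-leaf⇒entries≡2 A last≢1 i))
                         ; disconnection = disconnection }
  where open DisconnectedRealization (disconnected-2-regular 6≤n)
... | yes last≡1 with ∃-entry≥3 d (Admissible.∑≡n+n A) last≡1
...   | p , 3≤dp = attach (disconnected-realization reduced 6≤m admissible)
  where open RemoveLeaf d A last≡1 p 3≤dp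

unicyclic⇒admissible : ∀ {n} {d : Fin n → ℕ} → NonIncreasing d → (G : Graph n) → Realization d G →
  Connected G → edgeCount G ≡ n → (6≤n : 6 ≤ n) → d (fromℕ< 6≤n) ≢ 1 → Admissible d
unicyclic⇒admissible {0} _ _ _ _ _ () _
unicyclic⇒admissible {1} _ _ _ _ _ (s≤s ()) _
unicyclic⇒admissible {suc (suc n)} {d} nonIncreasing G realizes connected edges≡n 6≤n d₅≢1 = record
  { ∑≡n+n = trans (sum-cong-≗ d≡deg) (trans (handshake G) (cong₂ _+_ edges≡n edges≡n))
  ; positive = positive
  ; first-six≥2 = λ i i<6 → ≤-trans (≤∧≢⇒< (positive _) (d₅≢1 ∘ sym))
      (nonIncreasing i (fromℕ< 6≤n) (subst (toℕ i ≤_) (sym (Finₚ.toℕ-fromℕ< 6≤n)) (≤-pred i<6)))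
  ; ones-suffix = λ i≤j di≡1 → ≤-antisym (≤-trans (nonIncreasing _ _ i≤j) (≤-reflexive di≡1)) (positive _)
  }
  where
  d≡deg : ∀ i → d i ≡ deg G i
  d≡deg i = trans (sym (realizes i)) (degree≡deg G i)
  positive : ∀ i → 1 ≤ d i
  positive i = subst (1 ≤_) (sym (d≡deg i)) (connected⇒1≤deg G connected i)

lemma3p4 : (n : ℕ) → (d : Fin n → ℕ) → NonIncreasing d → ForciblyUnicyclic d →
    (h : 6 ≤ n) → d (fromℕ< {5} {n} h) ≡ 1
lemma3p4 n d nonIncreasing ((G₀ , realizes₀) , forced) 6≤n with d (fromℕ< 6≤n) ℕ.≟ 1
... | yes d₅≡1 = d₅≡1
... | no d₅≢1 = ⊥-elim (disconnection⇒¬connected disconnection (proj₁ (forced graph realizes)))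
  where
  admissible : Admissible d
  admissible = unicyclic⇒admissible nonIncreasing G₀ realizes₀
                 (proj₁ (forced G₀ realizes₀)) (proj₂ (forced G₀ realizes₀)) 6≤n d₅≢1
  open DisconnectedRealization (disconnected-realization d 6≤n admissible)
  realizes : Realization d graph
  realizes i = trans (degree≡deg graph i) (deg≡ i)
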